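{- Let $n \geq 2$ and let $H$ be a graph obtained from $n+1$ pairwise disjoint copies $K_n^0, K_n^1, \dots, K_n^n$ of the complete graph $K_n$ by adding, for every pair of distinct indices $i \neq j$, exactly one edge joining a vertex of $K_n^i$ to a vertex of $K_n^j$, in such a way that every vertex of each $K_n^i$ has exactly one neighbor not in $K_n^i$. Then $H$ is vertex-transitive.
   Context: A graph $G$ is vertex-transitive if for any two vertices $u,v$ of $G$ there is an automorphism of $G$ mapping $u$ to $v$. -}

module Defs where

open import Level using (Level; _⊔_; suc)
open import Data.Nat using (ℕ)
open import Data.Fin using (Fin)
open import Data.Bool using (Bool; true)
open import Data.Product using (Σ; _×_; _,_; proj₁; proj₂; ∃; ∃-syntax)
open import Data.Sum using (_⊎_)
open import Relation.Nullary using (¬_)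
open import Relation.Binary.PropositionalEquality using (_≡_)
open import Function.Bundles using (_↔_; _⇔_; Inverse)

record Graph (v ℓ : Level) : Set (Level.suc (v ⊔ ℓ)) where
  field
    Vertex : Set v
    Adj    : Vertex → Vertex → Set ℓ

module _ {v ℓ} (G : Graph v ℓ) where
  open Graph G

  record Automorphism : Set (v ⊔ ℓ) where
    field
      perm     : Vertex ↔ Vertex
      preserve : ∀ x y → Adj x y ⇔ Adj (Inverse.to perm x) (Inverse.to perm y)

  VertexTransitive : Set (v ⊔ ℓ)
  VertexTransitive =
    ∀ x y → Σ Automorphism λ σ → Inverse.to (Automorphism.perm σ) x ≡ y

-- Vertices of n+1 disjoint copies K_n^0,…,K_n^n of K_n:
-- (i , a) is vertex a of copy i.
V : ℕ → Set
V n = Fin (ℕ.suc n) × Fin n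

copy : ∀ {n} → V n → Fin (ℕ.suc n)
copy = proj₁

H : (n : ℕ) → (E : V n → V n → Bool) → Graph Level.zero Level.zero
H n E = record
  { Vertex = V n
  ; Adj    = λ u w → (copy u ≡ copy w × ¬ (proj₂ u ≡ proj₂ w)) ⊎ (E u w ≡ true)
  }

record AddedEdges (n : ℕ) (E : V n → V n → Bool) : Set where
  field
    symmetric   : ∀ u w → E u w ≡ true → E w u ≡ true
    crossCopies : ∀ u w → E u w ≡ true → ¬ (copy u ≡ copy w)
    exactlyOne  : ∀ i j → ¬ (i ≡ j) →
      ∃[ a ] ∃[ b ] (E (i , a) (j , b) ≡ true ×
        (∀ a' b' → E (i , a') (j , b') ≡ true → a' ≡ a × b' ≡ b))
    oneOutside  : ∀ u → ∃[ w ] (¬ (copy u ≡ copy w) × E u w ≡ true ×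
        (∀ w' → ¬ (copy u ≡ copy w') → E u w' ≡ true → w' ≡ w))

-- A vertex u of H is determined by its copy and by the copy reached by its unique
-- external edge, and these two copies differ; conversely every ordered pair of
-- distinct copies arises. In these coordinates, u ~ w iff they share the first
-- coordinate, or the coordinates of w are those of u swapped. Hence every permutation
-- of the n+1 copies acts on H by automorphisms, and since the symmetric group is
-- transitive on ordered pairs of distinct points, H is vertex-transitive.
module Submission where

open import Defs
open import Data.Nat using (ℕ; suc; _≤_)
open import Data.Bool using (Bool; true)
open import Data.Fin using (Fin)
open import Data.Fin.Properties using (_≟_)
open import Data.Fin.Permutation
  using (Permutation′; _⟨$⟩ʳ_; _⟨$⟩ˡ_; inverseˡ; inverseʳ; flip; transpose; _∘ₚ_)
open import Data.Product using (∃-syntax; _×_; _,_; proj₁; proj₂)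
open import Data.Sum using (inj₁; inj₂)
open import Function.Base using (_∘_)
open import Function.Bundles using (Injection; Equivalence; _⇔_; mk↔ₛ′; mk⇔)
open import Function.Properties.Inverse using (↔⇒↣)
open import Relation.Nullary.Decidable using (dec-true; dec-false)
open import Relation.Binary.PropositionalEquality

module _ {m : ℕ} where

  transpose-matchˡ : ∀ (i j : Fin m) → transpose i j ⟨$⟩ʳ i ≡ j
  transpose-matchˡ i j rewrite dec-true (i ≟ i) refl = refl

  transpose-mismatch : ∀ {i j k : Fin m} → k ≢ i → k ≢ j → transpose i j ⟨$⟩ʳ k ≡ k
  transpose-mismatch {i} {j} {k} k≢i k≢j
    rewrite dec-false (k ≟ i) k≢i | dec-false (k ≟ j) k≢j = refl

  permute-injective : ∀ (π : Permutation′ m) {i j} → π ⟨$⟩ʳ i ≡ π ⟨$⟩ʳ j → i ≡ j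
  permute-injective π = Injection.injective (↔⇒↣ π)

  -- First move i to k, then move the image of j to l while fixing k.
  permutations-2-transitive : ∀ {i j k l : Fin m} → i ≢ j → k ≢ l →
    ∃[ π ] (π ⟨$⟩ʳ i ≡ k × π ⟨$⟩ʳ j ≡ l)
  permutations-2-transitive {i} {j} {k} {l} i≢j k≢l =
    transpose i k ∘ₚ transpose j′ l ,
    trans (cong (transpose j′ l ⟨$⟩ʳ_) (transpose-matchˡ i k)) (transpose-mismatch k≢j′ k≢l) ,
    transpose-matchˡ j′ l
    where
    j′ : Fin m
    j′ = transpose i k ⟨$⟩ʳ j
    k≢j′ : k ≢ j′
    k≢j′ k≡j′ = i≢j (permute-injective (transpose i k) (trans (transpose-matchˡ i k) k≡j′))

module _ {n : ℕ} {E : V n → V n → Bool} (added : AddedEdges n E) where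
  open AddedEdges added

  outNeighbour : V n → V n
  outNeighbour u = proj₁ (oneOutside u)

  exit : V n → Fin (suc n)
  exit u = copy (outNeighbour u)

  copy≢exit : ∀ u → copy u ≢ exit u
  copy≢exit u = proj₁ (proj₂ (oneOutside u))

  E-outNeighbour : ∀ u → E u (outNeighbour u) ≡ true
  E-outNeighbour u = proj₁ (proj₂ (proj₂ (oneOutside u)))

  E⇒copy≡exit : ∀ {u w} → E u w ≡ true → copy w ≡ exit u
  E⇒copy≡exit {u} {w} uw =
    cong copy (proj₂ (proj₂ (proj₂ (oneOutside u))) w (crossCopies u w uw) uw)

  gate : ∀ (i j : Fin (suc n)) → i ≢ j → Fin n
  gate i j i≢j = proj₁ (exactlyOne i j i≢j)

  exit-gate : ∀ i j (i≢j : i ≢ j) → exit (i , gate i j i≢j) ≡ j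
  exit-gate i j i≢j = sym (E⇒copy≡exit (proj₁ (proj₂ (proj₂ (exactlyOne i j i≢j)))))

  gate-unique : ∀ {i j a} (i≢j : i ≢ j) → exit (i , a) ≡ j → gate i j i≢j ≡ a
  gate-unique {i} {j} {a} i≢j refl = sym (proj₁
    (proj₂ (proj₂ (proj₂ (exactlyOne i j i≢j))) a _ (E-outNeighbour (i , a))))

  vertex-≡ : ∀ {u w} → copy u ≡ copy w → exit u ≡ exit w → u ≡ w
  vertex-≡ {i , a} {.i , b} refl eq =
    cong (i ,_) (trans (sym (gate-unique i≢j refl)) (gate-unique i≢j (sym eq)))
    where
    i≢j : i ≢ exit (i , a)
    i≢j = copy≢exit (i , a)

  E⇔swapped : ∀ u w → E u w ≡ true ⇔ (copy w ≡ exit u × exit w ≡ copy u)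
  E⇔swapped u w = mk⇔
    (λ uw → E⇒copy≡exit uw , sym (E⇒copy≡exit (symmetric u w uw)))
    (λ (c , e) → subst (λ x → E u x ≡ true)
                       (vertex-≡ (sym c) (trans (sym (E⇒copy≡exit wu)) (sym e)))
                       (E-outNeighbour u))
    where
    wu : E (outNeighbour u) u ≡ true
    wu = symmetric u (outNeighbour u) (E-outNeighbour u)

  module _ (π : Permutation′ (suc n)) where

    act : V n → V n
    act (i , a) = π ⟨$⟩ʳ i , gate (π ⟨$⟩ʳ i) (π ⟨$⟩ʳ exit (i , a))
                                  (copy≢exit (i , a) ∘ permute-injective π)

    exit-act : ∀ u → exit (act u) ≡ π ⟨$⟩ʳ exit u
    exit-act (i , a) = exit-gate _ _ _

    act-≡ : ∀ {u w} → π ⟨$⟩ʳ copy u ≡ copy w → π ⟨$⟩ʳ exit u ≡ exit w → act u ≡ w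
    act-≡ {u} c e = vertex-≡ c (trans (exit-act u) e)

  act-inverseˡ : ∀ π u → act (flip π) (act π u) ≡ u
  act-inverseˡ π u = act-≡ (flip π) (inverseˡ π)
    (trans (cong (π ⟨$⟩ˡ_) (exit-act π u)) (inverseˡ π))

  act-inverseʳ : ∀ π u → act π (act (flip π) u) ≡ u
  act-inverseʳ π u = act-≡ π (inverseʳ π)
    (trans (cong (π ⟨$⟩ʳ_) (exit-act (flip π) u)) (inverseʳ π))

  act-injective : ∀ π {u w} → act π u ≡ act π w → u ≡ w
  act-injective π {u} {w} eq = begin
    u                       ≡⟨ act-inverseˡ π u ⟨
    act (flip π) (act π u)  ≡⟨ cong (act (flip π)) eq ⟩
    act (flip π) (act π w)  ≡⟨ act-inverseˡ π w ⟩
    w                       ∎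
    where open ≡-Reasoning

  Adj : V n → V n → Set
  Adj = Graph.Adj (H n E)

  act-preserves-Adj : ∀ π u w → Adj u w → Adj (act π u) (act π w)
  act-preserves-Adj π (i , a) (.i , b) (inj₁ (refl , a≢b)) =
    inj₁ (refl , λ eq → a≢b (cong proj₂ (act-injective π (cong (π ⟨$⟩ʳ i ,_) eq))))
  act-preserves-Adj π u w (inj₂ uw) with Equivalence.to (E⇔swapped u w) uw
  ... | c , e = inj₂ (Equivalence.from (E⇔swapped (act π u) (act π w))
                  (trans (cong (π ⟨$⟩ʳ_) c) (sym (exit-act π u)) ,
                   trans (exit-act π w) (cong (π ⟨$⟩ʳ_) e)))

  act-automorphism : Permutation′ (suc n) → Automorphism (H n E)
  act-automorphism π = record
    { perm     = mk↔ₛ′ (act π) (act (flip π)) (act-inverseʳ π) (act-inverseˡ π)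
    ; preserve = λ u w → mk⇔ (act-preserves-Adj π u w)
        (subst₂ Adj (act-inverseˡ π u) (act-inverseˡ π w) ∘ act-preserves-Adj (flip π) _ _)
    }

theorem2 : (n : ℕ) → 2 ≤ n → (E : V n → V n → Bool) → AddedEdges n E →
    VertexTransitive (H n E)
theorem2 n _ E added u w =
  let π , copy↦copy , exit↦exit = permutations-2-transitive (copy≢exit added u) (copy≢exit added w)
  in act-automorphism added π , act-≡ added π copy↦copy exit↦exit
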